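{- For $0\le i\le d+1$ let $\Gamma_i=\{0,\dots,d+1\}\setminus\{i\}$, regarded as the $d$-simplex $\langle\Gamma_i\rangle\subseteq\partial\sigma^{d+1}$. For $0\le i\le d-1$ let $\mathcal{C}_{d-i-1}(i+1,\dots,d)$ be the boundary complex of the $(d-i-1)$-dimensional cross-polytope on vertex set $\{i+1,\dots,d\}\cup\{v_{i+1},\dots,v_d\}$, and set $\mathcal{C}_{ -1}=\{\emptyset\}$. Then $$\Diamond(\Gamma_i)=\begin{cases}\langle\{0,\dots,i-1,v_i\}\rangle*\mathcal{C}_{d-i-1}(i+1,\dots,d) & \text{for } 0\le i\le d,\\ \langle\{0,\dots,d\}\rangle & \text{for } i=d+1.\end{cases}$$
   Context: $\sigma^{d+1}$ is the simplex on $\{0,\dots,d+1\}$. The boundary complex of the cross-polytope on $\{i+1,\dots,d\}\cup\{v_{i+1},\dots,v_d\}$ has as facets the sets containing exactly one of $j,v_j$ for each $i+1\le j\le d$. For a pure $d$-dimensional subcomplex $\Gamma\subseteq\partial\sigma^{d+1}$, $\Diamond(\Gamma)$ is obtained by performing, for $i=0,1,\dots,d$ in this order: if $F_i=\{i+1,\dots,d+1\}$ is a face of the current complex, replace the current complex $K$ by its stellar subdivision $(K\setminus F_i)\cup(\langle v_i\rangle*\partial F_i*\mathrm{lk}_K(F_i))$ at $F_i$, with new vertex named $v_i$ (here $K\setminus F=\{G\in K:F\not\subseteq G\}$, $\partial F$ is the complex of proper subsets of $F$; for $i=d$ this renames vertex $d+1$ as $v_d$). $*$ denotes the join and $\langle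 S\rangle$ the simplex on $S$. -}

module Defs where

open import Data.Nat.Base using (ℕ; zero; suc; _+_; _<ᵇ_; _≡ᵇ_; _≤ᵇ_)
open import Data.Fin.Base using (Fin; toℕ; inject₁; fromℕ)
open import Data.Bool.Base using (Bool; true; false; _∧_; _∨_; not; _xor_)
open import Data.List.Base using (foldl; allFin)
open import Data.Product using (Σ; _×_; ∃; ∃-syntax)
open import Data.Sum using (_⊎_)
open import Relation.Nullary using (¬_)
open import Relation.Binary.PropositionalEquality using (_≡_)

-- Vertices for a fixed d: the original vertices 0..d+1 and the
-- new vertices v_0..v_d created by the stellar subdivisions.
data Vtx (d : ℕ) : Set where
  old : Fin (suc (suc d)) → Vtx d
  new : Fin (suc d) → Vtx d

Face : ℕ → Set
Face d = Vtx d → Bool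

_∋_ : ∀ {d} → Face d → Vtx d → Set
G ∋ x = G x ≡ true

_⊆_ : ∀ {d} → Face d → Face d → Set
G ⊆ H = ∀ x → G ∋ x → H ∋ x

_∪_ : ∀ {d} → Face d → Face d → Face d
(G ∪ H) x = G x ∨ H x

_≐_ : ∀ {d} → Face d → Face d → Set
G ≐ H = ∀ x → G x ≡ H x

Disjoint : ∀ {d} → Face d → Face d → Set
Disjoint G H = ∀ x → ¬ (G ∋ x × H ∋ x)

Complex : ℕ → Set₁
Complex d = Face d → Set

_≅_ : ∀ {d} → Complex d → Complex d → Set
K ≅ L = ∀ G → (K G → L G) × (L G → K G)

⟨_⟩ : ∀ {d} → Face d → Complex d
⟨ S ⟩ G = G ⊆ S

∂ : ∀ {d} → Face d → Complex d
∂ F G = G ⊆ F × ¬ (F ⊆ G)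

_∖_ : ∀ {d} → Complex d → Face d → Complex d
(K ∖ F) G = K G × ¬ (F ⊆ G)

lk : ∀ {d} → Complex d → Face d → Complex d
lk K F G = K G × Disjoint G F × K (G ∪ F)

-- join (used only on complexes with disjoint vertex sets)
_✶_ : ∀ {d} → Complex d → Complex d → Complex d
(K ✶ L) G = ∃[ A ] ∃[ B ] (K A × L B × G ≐ (A ∪ B))

｛_｝ : ∀ {d} → Vtx d → Face d
｛ old i ｝ (old j) = toℕ i ≡ᵇ toℕ j
｛ old i ｝ (new j) = false
｛ new i ｝ (old j) = false
｛ new i ｝ (new j) = toℕ i ≡ᵇ toℕ j

stellar : ∀ {d} → Complex d → Face d → Vtx d → Complex d
stellar K F v G = (K ∖ F) G ⊎ ((⟨ ｛ v ｝ ⟩ ✶ ∂ F) ✶ lk K F) G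

Fface : ∀ {d} → Fin (suc d) → Face d
Fface i (old j) = toℕ i <ᵇ toℕ j
Fface i (new j) = false

step : ∀ {d} → Complex d → Fin (suc d) → Complex d
step K i G = (K (Fface i) × stellar K (Fface i) (new i) G)
           ⊎ (¬ K (Fface i) × K G)

◇ : ∀ {d} → Complex d → Complex d
◇ {d} Γ = foldl step Γ (allFin (suc d))

Γface : ∀ {d} → Fin (suc (suc d)) → Face d
Γface i (old j) = not (toℕ i ≡ᵇ toℕ j)
Γface i (new j) = false

headFace : ∀ {d} → Fin (suc d) → Face d
headFace i (old j) = toℕ j <ᵇ toℕ i
headFace i (new j) = toℕ j ≡ᵇ toℕ i

allButLast : ∀ {d} → Face d
allButLast {d} (old j) = toℕ j ≤ᵇ d
allButLast (new j) = false

-- facets of the boundary of the cross-polytope on {i+1..d} ∪ {v_{i+1}..v_d}: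
-- sets in that vertex set containing exactly one of j, v_j for each i+1 ≤ j ≤ d
crossFacet : ∀ {d} → Fin (suc d) → Face d → Set
crossFacet {d} i H =
  (∀ j → H ∋ old j → (toℕ i <ᵇ toℕ j) ∧ (toℕ j ≤ᵇ d) ≡ true)
  × (∀ j → H ∋ new j → (toℕ i <ᵇ toℕ j) ≡ true)
  × (∀ (j : Fin (suc d)) → (toℕ i <ᵇ toℕ j) ≡ true →
       (H (old (inject₁ j)) xor H (new j)) ≡ true)

-- 𝒞_{d-i-1}(i+1,...,d): the complex generated by these facets
-- (for i = d this is {∅} = 𝒞_{-1})
cross : ∀ {d} → Fin (suc d) → Complex d
cross i G = ∃[ H ] (crossFacet i H × G ⊆ H)

-- After the steps 0, …, n − 1 the complex consists of the sets G
-- avoiding i whose new vertices lie among v_i, …, v_{n−1}, that contain no pair j, v_j with j < n,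
-- and that do not contain all of n, …, d + 1. For n < i the face F_n contains i, so it is not a
-- face and nothing happens. For n ≥ i the stellar subdivision at F_n = {n+1, …, d+1} replaces
-- "not all of n, …, d+1" by "not all of n+1, …, d+1" and "not both n and v_n": a face containing
-- v_n is a cone over G ∖ v_n, which together with F_n is a face of the previous complex.
-- After the last step, for i = d + 1 this is the simplex on 0, …, d; for i ≤ d the part of G outside
-- {0, …, i−1, v_i} is any set of vertices j, v_j (i < j ≤ d) free of antipodal pairs, i.e. a face of
-- the boundary of the cross-polytope.

module Submission where

open import Defs
open import Data.Nat.Base using (ℕ; suc)
open import Data.Fin.Base using (Fin; inject₁; fromℕ)
open import Data.Product using (_×_)

open import Data.Bool.Base using (true; false; T; _∧_; _∨_; not; _xor_)
open import Data.Bool.Properties using (∨-zeroʳ; ∧-conicalˡ; ∧-conicalʳ; xor-inverseʳ)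
  renaming (_≟_ to _≟ᵇ_)
open import Data.Nat.Base using (zero; _+_; _<ᵇ_; _≡ᵇ_; _≤ᵇ_; _≤_; _<_; z≤n; s≤s⁻¹)
open import Data.Nat.Properties
  using (_≟_; <ᵇ⇒<; <⇒<ᵇ; ≤ᵇ⇒≤; ≤⇒≤ᵇ; ≡ᵇ⇒≡; ≡⇒≡ᵇ; _<?_; ≤-refl; ≤-reflexive; ≤-trans; ≤-antisym;
         <⇒≤; <⇒≱; ≮⇒≥; ≤∧≢⇒<; <-irrefl; <-asym; 1+n≰n; n≤1+n; m<n⇒m<1+n; +-identityʳ; +-suc)
import Data.Fin.Base as Fin
open import Data.Fin.Base using (toℕ)
open import Data.Fin.Properties using (toℕ-injective; toℕ<n; toℕ-inject₁; toℕ-fromℕ)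
open import Data.List.Base using (foldl; tabulate)
open import Data.Product using (_,_; proj₁; proj₂)
open import Data.Sum using (_⊎_; inj₁; inj₂; [_,_]′)
open import Function using (_∘_; id)
open import Relation.Nullary using (¬_; Dec; yes; no; contradiction)
open import Relation.Binary.PropositionalEquality using (_≡_; _≢_; refl; sym; trans; cong; cong₂; subst)

private
  true⇒T : ∀ {b} → b ≡ true → T b
  true⇒T refl = _

  T⇒true : ∀ {b} → T b → b ≡ true
  T⇒true {true} _ = refl

<ᵇ-true⇒< : ∀ {m n} → (m <ᵇ n) ≡ true → m < n
<ᵇ-true⇒< {m} {n} = <ᵇ⇒< m n ∘ true⇒T

<⇒<ᵇ-true : ∀ {m n} → m < n → (m <ᵇ n) ≡ true
<⇒<ᵇ-true = T⇒true ∘ <⇒<ᵇ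

≤ᵇ-true⇒≤ : ∀ {m n} → (m ≤ᵇ n) ≡ true → m ≤ n
≤ᵇ-true⇒≤ {m} {n} = ≤ᵇ⇒≤ m n ∘ true⇒T

≤⇒≤ᵇ-true : ∀ {m n} → m ≤ n → (m ≤ᵇ n) ≡ true
≤⇒≤ᵇ-true = T⇒true ∘ ≤⇒≤ᵇ

≡ᵇ-true⇒≡ : ∀ {m n} → (m ≡ᵇ n) ≡ true → m ≡ n
≡ᵇ-true⇒≡ {m} {n} = ≡ᵇ⇒≡ m n ∘ true⇒T

≡⇒≡ᵇ-true : ∀ {m n} → m ≡ n → (m ≡ᵇ n) ≡ true
≡⇒≡ᵇ-true {m} {n} = T⇒true ∘ ≡⇒≡ᵇ m n

not-true⇒¬true : ∀ {b} → not b ≡ true → ¬ b ≡ true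
not-true⇒¬true {false} _ ()

¬true⇒not-true : ∀ {b} → ¬ b ≡ true → not b ≡ true
¬true⇒not-true {true} b≢true = contradiction refl b≢true
¬true⇒not-true {false} _ = refl

_∩_ : ∀ {d} → Face d → Face d → Face d
(G ∩ H) y = G y ∧ H y

_─_ : ∀ {d} → Face d → Face d → Face d
(G ─ H) y = G y ∧ not (H y)

module _ {d : ℕ} (G H : Face d) {y : Vtx d} where

  ∪-∋⁻ : (G ∪ H) ∋ y → G ∋ y ⊎ H ∋ y
  ∪-∋⁻ g∨h with G y
  ... | true  = inj₁ refl
  ... | false = inj₂ g∨h

  ∪-∋ˡ : G ∋ y → (G ∪ H) ∋ y
  ∪-∋ˡ g = cong (_∨ H y) g

  ∪-∋ʳ : H ∋ y → (G ∪ H) ∋ y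
  ∪-∋ʳ h = trans (cong (G y ∨_) h) (∨-zeroʳ (G y))

  ∩-∋⁻ : (G ∩ H) ∋ y → G ∋ y × H ∋ y
  ∩-∋⁻ g∧h = ∧-conicalˡ (G y) (H y) g∧h , ∧-conicalʳ (G y) (H y) g∧h

  ─-∋⁻ : (G ─ H) ∋ y → G ∋ y × ¬ H ∋ y
  ─-∋⁻ g∧¬h = ∧-conicalˡ (G y) _ g∧¬h , not-true⇒¬true (∧-conicalʳ (G y) _ g∧¬h)

  ─-∋ : G ∋ y → ¬ H ∋ y → (G ─ H) ∋ y
  ─-∋ g ¬h = cong₂ _∧_ g (¬true⇒not-true ¬h)

  ─-split : G ∋ y → H ∋ y ⊎ (G ─ H) ∋ y
  ─-split g with H y ≟ᵇ true
  ... | yes h  = inj₁ h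
  ... | no  ¬h = inj₂ (─-∋ g ¬h)

｛｝-∋⁻ : ∀ {d} (v : Vtx d) {y : Vtx d} → ｛ v ｝ ∋ y → y ≡ v
｛｝-∋⁻ (old i) {old j} i≡j = cong old (toℕ-injective (sym (≡ᵇ-true⇒≡ i≡j)))
｛｝-∋⁻ (new i) {new j} i≡j = cong new (toℕ-injective (sym (≡ᵇ-true⇒≡ i≡j)))

｛｝-∋ : ∀ {d} (v : Vtx d) → ｛ v ｝ ∋ v
｛｝-∋ (old i) = ≡⇒≡ᵇ-true {toℕ i} refl
｛｝-∋ (new i) = ≡⇒≡ᵇ-true {toℕ i} refl

─｛｝-∋ : ∀ {d} (G : Face d) (v : Vtx d) {y : Vtx d} → G ∋ y → y ≢ v → (G ─ ｛ v ｝) ∋ y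
─｛｝-∋ G v g y≢v = ─-∋ G ｛ v ｝ g (y≢v ∘ ｛｝-∋⁻ v)

─｛｝-split : ∀ {d} (G : Face d) (v : Vtx d) {y : Vtx d} → G ∋ y → y ≡ v ⊎ (G ─ ｛ v ｝) ∋ y
─｛｝-split G v g = [ inj₁ ∘ ｛｝-∋⁻ v , inj₂ ]′ (─-split G ｛ v ｝ g)

≅-sym : ∀ {d} {K L : Complex d} → K ≅ L → L ≅ K
≅-sym K≅L G = proj₂ (K≅L G) , proj₁ (K≅L G)

≅-trans : ∀ {d} {K L M : Complex d} → K ≅ L → L ≅ M → K ≅ M
≅-trans K≅L L≅M G = proj₁ (L≅M G) ∘ proj₁ (K≅L G) , proj₂ (K≅L G) ∘ proj₂ (L≅M G)

DownClosed : ∀ {d} → Complex d → Set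
DownClosed K = ∀ {G H} → G ⊆ H → K H → K G

private
  ∧-∨-∧-not : ∀ a b → a ≡ (a ∧ b) ∨ (a ∧ not b)
  ∧-∨-∧-not true  true  = refl
  ∧-∨-∧-not true  false = refl
  ∧-∨-∧-not false _     = refl

simplex-✶ : ∀ {d} (S : Face d) {L : Complex d} → DownClosed L → (⟨ S ⟩ ✶ L) ≅ (λ G → L (G ─ S))
simplex-✶ S {L} L-down G = to , from
  where
    to : (⟨ S ⟩ ✶ L) G → L (G ─ S)
    to (A , B , A⊆S , lB , G≐A∪B) = L-down G─S⊆B lB
      where
        G─S⊆B : (G ─ S) ⊆ B
        G─S⊆B y g─s with ─-∋⁻ G S g─s
        ... | g , ¬s = [ (λ a → contradiction (A⊆S y a) ¬s) , id ]′
                         (∪-∋⁻ A B (trans (sym (G≐A∪B y)) g))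
    from : L (G ─ S) → (⟨ S ⟩ ✶ L) G
    from l = G ∩ S , G ─ S , (λ y g∩s → proj₂ (∩-∋⁻ G S g∩s)) , l , λ y → ∧-∨-∧-not (G y) (S y)

StellarFace : ∀ {d} → Complex d → Face d → Vtx d → Complex d
StellarFace K F v G =
  (K G × ¬ F ⊆ G) ⊎ (G ∋ v × ¬ F ⊆ (G ─ ｛ v ｝) × K ((G ─ ｛ v ｝) ∪ F))

private
  cone-decomposition : ∀ g s f → (s ≡ true → g ≡ true) → g ≡ (s ∨ (g ∧ f)) ∨ ((g ∧ not s) ∧ not f)
  cone-decomposition true  true  _     _   = refl
  cone-decomposition true  false true  _   = refl
  cone-decomposition true  false false _   = refl
  cone-decomposition false true  _     s⇒g = contradiction (s⇒g refl) λ ()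
  cone-decomposition false false _     _   = refl

module _ {d : ℕ} {K : Complex d} (K-down : DownClosed K) {F : Face d} {v : Vtx d} (v∉F : ¬ F ∋ v) where

  stellar⇒StellarFace : ∀ G → stellar K F v G → StellarFace K F v G
  stellar⇒StellarFace G (inj₁ kG) = inj₁ kG
  stellar⇒StellarFace G (inj₂ (AB , C , (A , B , A⊆v , (B⊆F , F⊈B) , AB≐A∪B) , (_ , C#F , kC∪F) , G≐AB∪C)) =
    decide (G v ≟ᵇ true)
    where
      off-v : ∀ {y} → G ∋ y → y ≢ v → (B ∪ C) ∋ y
      off-v {y} g y≢v with ∪-∋⁻ AB C (trans (sym (G≐AB∪C y)) g)
      ... | inj₂ c  = ∪-∋ʳ B C c
      ... | inj₁ ab = [ (λ a → contradiction (｛｝-∋⁻ v (A⊆v y a)) y≢v) , ∪-∋ˡ B C ]′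
                        (∪-∋⁻ A B (trans (sym (AB≐A∪B y)) ab))

      K-∪F : ∀ X → X ⊆ (B ∪ C) → K (X ∪ F)
      K-∪F X X⊆B∪C = K-down X∪F⊆C∪F kC∪F
        where
          X∪F⊆C∪F : (X ∪ F) ⊆ (C ∪ F)
          X∪F⊆C∪F y x∪f =
            [ [ ∪-∋ʳ C F ∘ B⊆F y , ∪-∋ˡ C F ]′ ∘ ∪-∋⁻ B C ∘ X⊆B∪C y , ∪-∋ʳ C F ]′ (∪-∋⁻ X F x∪f)

      F⊈ : ∀ X → X ⊆ (B ∪ C) → ¬ F ⊆ X
      F⊈ X X⊆B∪C F⊆X =
        F⊈B λ y f → [ id , (λ c → contradiction (c , f) (C#F y)) ]′ (∪-∋⁻ B C (X⊆B∪C y (F⊆X y f)))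

      decide : Dec (G ∋ v) → StellarFace K F v G
      decide (yes g∋v) = inj₂ (g∋v , F⊈ (G ─ ｛ v ｝) G─v⊆B∪C , K-∪F (G ─ ｛ v ｝) G─v⊆B∪C)
        where
          G─v⊆B∪C : (G ─ ｛ v ｝) ⊆ (B ∪ C)
          G─v⊆B∪C y g─v with ─-∋⁻ G ｛ v ｝ g─v
          ... | g , y∉v = off-v g (λ y≡v → y∉v (subst (｛ v ｝ ∋_) (sym y≡v) (｛｝-∋ v)))
      decide (no g∌v) = inj₁ (K-down (λ y → ∪-∋ˡ G F) (K-∪F G G⊆B∪C) , F⊈ G G⊆B∪C)
        where
          G⊆B∪C : G ⊆ (B ∪ C)
          G⊆B∪C y g = off-v g (λ y≡v → g∌v (subst (G ∋_) y≡v g))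

  StellarFace⇒stellar : ∀ G → StellarFace K F v G → stellar K F v G
  StellarFace⇒stellar G (inj₁ kG) = inj₁ kG
  StellarFace⇒stellar G (inj₂ (g∋v , F⊈G─v , kG─v∪F)) =
    inj₂ ( ｛ v ｝ ∪ (G ∩ F) , C
         , (｛ v ｝ , G ∩ F , (λ _ → id) , (G∩F⊆F , F⊈G∩F) , (λ _ → refl))
         , (K-down C⊆G─v∪F kG─v∪F , C#F , K-down C∪F⊆G─v∪F kG─v∪F)
         , G≐v∪G∩F∪C )
    where
      C : Face d
      C = (G ─ ｛ v ｝) ─ F

      G∩F⊆F : (G ∩ F) ⊆ F
      G∩F⊆F y = proj₂ ∘ ∩-∋⁻ G F

      F⊈G∩F : ¬ F ⊆ (G ∩ F)
      F⊈G∩F F⊆G∩F = F⊈G─v λ y f →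
        ─｛｝-∋ G v (proj₁ (∩-∋⁻ G F (F⊆G∩F y f))) (λ y≡v → v∉F (subst (F ∋_) y≡v f))

      C⊆G─v∪F : C ⊆ ((G ─ ｛ v ｝) ∪ F)
      C⊆G─v∪F y = ∪-∋ˡ (G ─ ｛ v ｝) F ∘ proj₁ ∘ ─-∋⁻ (G ─ ｛ v ｝) F

      C#F : Disjoint C F
      C#F y (c , f) = proj₂ (─-∋⁻ (G ─ ｛ v ｝) F c) f

      C∪F⊆G─v∪F : (C ∪ F) ⊆ ((G ─ ｛ v ｝) ∪ F)
      C∪F⊆G─v∪F y = [ C⊆G─v∪F y , ∪-∋ʳ (G ─ ｛ v ｝) F ]′ ∘ ∪-∋⁻ C F

      G≐v∪G∩F∪C : G ≐ ((｛ v ｝ ∪ (G ∩ F)) ∪ C)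
      G≐v∪G∩F∪C y = cone-decomposition (G y) (｛ v ｝ y) (F y)
                       (λ y∈v → subst (G ∋_) (sym (｛｝-∋⁻ v y∈v)) g∋v)

  stellar≅StellarFace : stellar K F v ≅ StellarFace K F v
  stellar≅StellarFace G = stellar⇒StellarFace G , StellarFace⇒stellar G

module _ {d : ℕ} (x : Fin (suc d)) where

  step-cong : ∀ {K L : Complex d} → K ≅ L → step K x ≅ step L x
  step-cong K≅L G = step-map K≅L , step-map (≅-sym K≅L)
    where
      step-map : ∀ {K L : Complex d} → K ≅ L → step K x G → step L x G
      step-map K≅L (inj₁ (kF , inj₁ (kG , F⊈G))) = inj₁ (proj₁ (K≅L _) kF , inj₁ (proj₁ (K≅L G) kG , F⊈G))
      step-map K≅L (inj₁ (kF , inj₂ (A , C , a , (kC , C#F , kC∪F) , G≐A∪C))) =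
        inj₁ (proj₁ (K≅L _) kF , inj₂ (A , C , a , (proj₁ (K≅L C) kC , C#F , proj₁ (K≅L _) kC∪F) , G≐A∪C))
      step-map K≅L (inj₂ (¬kF , kG)) = inj₂ (¬kF ∘ proj₂ (K≅L _) , proj₁ (K≅L G) kG)

  step-face : ∀ {K : Complex d} → K (Fface x) → step K x ≅ stellar K (Fface x) (new x)
  step-face kF G = (λ { (inj₁ (_ , s)) → s ; (inj₂ (¬kF , _)) → contradiction kF ¬kF })
                 , (λ s → inj₁ (kF , s))

  step-nonface : ∀ {K : Complex d} → ¬ K (Fface x) → step K x ≅ K
  step-nonface ¬kF G = (λ { (inj₁ (kF , _)) → contradiction kF ¬kF ; (inj₂ (_ , kG)) → kG })
                     , (λ kG → inj₂ (¬kF , kG))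

module _ {d : ℕ} (P : ℕ → Complex d) (step-P : ∀ x → step (P (toℕ x)) x ≅ P (suc (toℕ x))) where

  foldl-step-≅ : ∀ {n c} {K : Complex d} (f : Fin n → Fin (suc d)) → (∀ j → toℕ (f j) ≡ c + toℕ j)
               → K ≅ P c → foldl step K (tabulate f) ≅ P (c + n)
  foldl-step-≅ {zero} {c} {K} _ _ K≅Pc = subst (λ m → K ≅ P m) (sym (+-identityʳ c)) K≅Pc
  foldl-step-≅ {suc n} {c} {K} f f≗c+ K≅Pc =
    subst (λ m → foldl step (step K (f Fin.zero)) (tabulate (f ∘ Fin.suc)) ≅ P m) (sym (+-suc c n))
      (foldl-step-≅ (f ∘ Fin.suc) (λ j → trans (f≗c+ (Fin.suc j)) (+-suc c (toℕ j)))
        (≅-trans (step-cong (f Fin.zero) K≅Pc)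
          (subst (λ m → step (P m) (f Fin.zero) ≅ P (suc m)) f₀≡c (step-P (f Fin.zero)))))
    where
      f₀≡c : toℕ (f Fin.zero) ≡ c
      f₀≡c = trans (f≗c+ Fin.zero) (+-identityʳ c)

  ◇-≅ : ∀ {K : Complex d} → K ≅ P 0 → ◇ K ≅ P (suc d)
  ◇-≅ = foldl-step-≅ id (λ _ → refl)

-- The complex after the steps 0, …, n − 1 of ◇(Γ_i)

record Stage {d} (i : Fin (suc (suc d))) (n : ℕ) (G : Face d) : Set where
  field
    omits-i      : ¬ G ∋ old i
    new-range    : ∀ j → G ∋ new j → toℕ i ≤ toℕ j × toℕ j < n
    no-antipodal : ∀ j → toℕ j < n → G ∋ old (inject₁ j) → ¬ G ∋ new j
    misses-tail  : ¬ (∀ j → n ≤ toℕ j → G ∋ old j)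

open Stage

module _ {d : ℕ} {i : Fin (suc (suc d))} where

  Stage-downClosed : ∀ {n} → DownClosed (Stage i n)
  Stage-downClosed G⊆H s .omits-i g = s .omits-i (G⊆H _ g)
  Stage-downClosed G⊆H s .new-range j g = s .new-range j (G⊆H _ g)
  Stage-downClosed G⊆H s .no-antipodal j j<n o w = s .no-antipodal j j<n (G⊆H _ o) (G⊆H _ w)
  Stage-downClosed G⊆H s .misses-tail tail = s .misses-tail (λ j n≤j → G⊆H _ (tail j n≤j))

  omits⇒misses-tail : ∀ {n} {G : Face d} → n ≤ toℕ i → ¬ G ∋ old i → ¬ (∀ j → n ≤ toℕ j → G ∋ old j)
  omits⇒misses-tail n≤i i∉G tail = i∉G (tail i n≤i)

  Stage-suc : ∀ {k} {G : Face d} → Stage i k G → ¬ (∀ j → suc k ≤ toℕ j → G ∋ old j) → Stage i (suc k) G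
  Stage-suc s _ .omits-i = s .omits-i
  Stage-suc s _ .new-range j g with s .new-range j g
  ... | i≤j , j<k = i≤j , m<n⇒m<1+n j<k
  Stage-suc s _ .no-antipodal j _ o w = s .no-antipodal j (proj₂ (s .new-range j w)) o w
  Stage-suc s misses .misses-tail = misses

  Stage-pred : ∀ {k} {G : Face d} → Stage i (suc k) G → (∀ j → toℕ j ≡ k → ¬ G ∋ new j) → Stage i k G
  Stage-pred s _ .omits-i = s .omits-i
  Stage-pred s vₖ∉G .new-range j g with s .new-range j g
  ... | i≤j , j≤k = i≤j , ≤∧≢⇒< (s≤s⁻¹ j≤k) (λ j≡k → vₖ∉G j j≡k g)
  Stage-pred s _ .no-antipodal j j<k = s .no-antipodal j (m<n⇒m<1+n j<k)
  Stage-pred {k} s _ .misses-tail tail = s .misses-tail (λ j k<j → tail j (≤-trans (n≤1+n k) k<j))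

module _ {d : ℕ} (x : Fin (suc d)) where

  Fface-∋⁻ : ∀ {j} → Fface x ∋ old j → toℕ x < toℕ j
  Fface-∋⁻ = <ᵇ-true⇒<

  Fface-∋ : ∀ {j} → toℕ x < toℕ j → Fface x ∋ old j
  Fface-∋ = <⇒<ᵇ-true

  Fface-∌-self : ¬ Fface x ∋ old (inject₁ x)
  Fface-∌-self = <-irrefl (sym (toℕ-inject₁ x)) ∘ Fface-∋⁻

  tail⇒Fface⊆ : ∀ {G : Face d} → (∀ j → suc (toℕ x) ≤ toℕ j → G ∋ old j) → Fface x ⊆ G
  tail⇒Fface⊆ tail (old j) f = tail j (Fface-∋⁻ f)

module _ {d : ℕ} {i : Fin (suc (suc d))} (x : Fin (suc d)) where

  step-Stage-below : toℕ x < toℕ i → step (Stage i (toℕ x)) x ≅ Stage i (suc (toℕ x))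
  step-Stage-below x<i = ≅-trans (step-nonface x Fface∉Stage) λ G →
      (λ s → Stage-suc s (omits⇒misses-tail {G = G} x<i (s .omits-i)))
    , (λ s → Stage-pred s λ j j≡x w → <⇒≱ (subst (_< toℕ i) (sym j≡x) x<i) (proj₁ (s .new-range j w)))
    where
      Fface∉Stage : ¬ Stage i (toℕ x) (Fface x)
      Fface∉Stage s = s .omits-i (Fface-∋ x x<i)

  module _ (i≤x : toℕ i ≤ toℕ x) where

    Fface∈Stage : Stage i (toℕ x) (Fface x)
    Fface∈Stage .omits-i f = <⇒≱ (Fface-∋⁻ x f) i≤x
    Fface∈Stage .new-range j ()
    Fface∈Stage .no-antipodal j _ _ ()
    Fface∈Stage .misses-tail tail = Fface-∌-self x (tail (inject₁ x) (≤-reflexive (sym (toℕ-inject₁ x))))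

    StellarFace⇒Stage : ∀ G → StellarFace (Stage i (toℕ x)) (Fface x) (new x) G → Stage i (suc (toℕ x)) G
    StellarFace⇒Stage G (inj₁ (s , F⊈G)) = Stage-suc s (F⊈G ∘ tail⇒Fface⊆ x {G})
    StellarFace⇒Stage G (inj₂ (vₓ∈G , F⊈G─vₓ , s)) = t
      where
        G─vₓ : Face d
        G─vₓ = G ─ ｛ new x ｝

        ∈G─vₓ∪F : ∀ {y} → G ∋ y → y ≢ new x → (G─vₓ ∪ Fface x) ∋ y
        ∈G─vₓ∪F g y≢vₓ = ∪-∋ˡ G─vₓ (Fface x) (─｛｝-∋ G (new x) g y≢vₓ)

        t : Stage i (suc (toℕ x)) G
        t .omits-i g = s .omits-i (∈G─vₓ∪F g λ ())
        t .new-range j g with ─｛｝-split G (new x) g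
        ... | inj₁ refl = i≤x , ≤-refl
        ... | inj₂ g─vₓ with s .new-range j (∪-∋ˡ G─vₓ (Fface x) g─vₓ)
        ...   | i≤j , j<x = i≤j , m<n⇒m<1+n j<x
        t .no-antipodal j _ o w with ─｛｝-split G (new x) w
        ... | inj₁ refl = s .misses-tail tail
          -- x together with F_x = {x+1, …, d+1} would make (G ∖ v_x) ∪ F_x contain its whole tail
          where
            tail : ∀ j' → toℕ x ≤ toℕ j' → (G─vₓ ∪ Fface x) ∋ old j'
            tail j' x≤j' with toℕ x ≟ toℕ j'
            ... | yes x≡j' = ∈G─vₓ∪F (subst (λ z → G ∋ old z) (toℕ-injective (trans (toℕ-inject₁ x) x≡j')) o) λ ()
            ... | no  x≢j' = ∪-∋ʳ G─vₓ (Fface x) (Fface-∋ x (≤∧≢⇒< x≤j' x≢j'))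
        ... | inj₂ g─vₓ =
          s .no-antipodal j (proj₂ (s .new-range j (∪-∋ˡ G─vₓ (Fface x) g─vₓ)))
            (∈G─vₓ∪F o λ ()) (∪-∋ˡ G─vₓ (Fface x) g─vₓ)
        t .misses-tail tail = F⊈G─vₓ F⊆G─vₓ
          where
            F⊆G─vₓ : Fface x ⊆ G─vₓ
            F⊆G─vₓ (old j) f = ─｛｝-∋ G (new x) (tail⇒Fface⊆ x {G} tail (old j) f) λ ()

    Stage⇒StellarFace : ∀ G → Stage i (suc (toℕ x)) G → StellarFace (Stage i (toℕ x)) (Fface x) (new x) G
    Stage⇒StellarFace G s = decide (G (new x) ≟ᵇ true)
      where
        F⊈ : ∀ {H} → H ⊆ G → ¬ Fface x ⊆ H
        F⊈ H⊆G F⊆H = s .misses-tail λ j x<j → H⊆G (old j) (F⊆H (old j) (Fface-∋ x x<j))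

        decide : Dec (G ∋ new x) → StellarFace (Stage i (toℕ x)) (Fface x) (new x) G
        decide (no vₓ∉G) = inj₁ (Stage-pred s vₓ≠ , F⊈ λ _ → id)
          where
            vₓ≠ : ∀ j → toℕ j ≡ toℕ x → ¬ G ∋ new j
            vₓ≠ j j≡x = subst (λ z → ¬ G ∋ new z) (sym (toℕ-injective j≡x)) vₓ∉G
        decide (yes vₓ∈G) = inj₂ (vₓ∈G , F⊈ G─vₓ⊆G , t)
          where
            G─vₓ : Face d
            G─vₓ = G ─ ｛ new x ｝

            G─vₓ⊆G : G─vₓ ⊆ G
            G─vₓ⊆G y = proj₁ ∘ ─-∋⁻ G ｛ new x ｝

            s⁻ : Stage i (toℕ x) G─vₓ
            s⁻ = Stage-pred (Stage-downClosed G─vₓ⊆G s) λ j j≡x g─vₓ →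
                   proj₂ (─-∋⁻ G ｛ new x ｝ g─vₓ) (≡⇒≡ᵇ-true {toℕ x} (sym j≡x))

            t : Stage i (toℕ x) (G─vₓ ∪ Fface x)
            t .omits-i h = [ s⁻ .omits-i , (λ f → <⇒≱ (Fface-∋⁻ x f) i≤x) ]′ (∪-∋⁻ G─vₓ (Fface x) h)
            t .new-range j h = [ s⁻ .new-range j , (λ ()) ]′ (∪-∋⁻ G─vₓ (Fface x) h)
            t .no-antipodal j j<x o w =
              [ (λ o⁻ → s⁻ .no-antipodal j j<x o⁻ w⁻)
              , (λ f → <-asym j<x (subst (toℕ x <_) (toℕ-inject₁ j) (Fface-∋⁻ x f))) ]′
              (∪-∋⁻ G─vₓ (Fface x) o)
              where
                w⁻ : G─vₓ ∋ new j
                w⁻ = [ id , (λ ()) ]′ (∪-∋⁻ G─vₓ (Fface x) w)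
            t .misses-tail tail =
              [ (λ o⁻ → s .no-antipodal x ≤-refl (G─vₓ⊆G _ o⁻) vₓ∈G) , Fface-∌-self x ]′
              (∪-∋⁻ G─vₓ (Fface x) (tail (inject₁ x) (≤-reflexive (sym (toℕ-inject₁ x)))))

    step-Stage-above : step (Stage i (toℕ x)) x ≅ Stage i (suc (toℕ x))
    step-Stage-above =
      ≅-trans (step-face x Fface∈Stage)
        (≅-trans (stellar≅StellarFace Stage-downClosed λ ())
          λ G → StellarFace⇒Stage G , Stage⇒StellarFace G)

step-Stage : ∀ {d} (i : Fin (suc (suc d))) (x : Fin (suc d)) → step (Stage i (toℕ x)) x ≅ Stage i (suc (toℕ x))
step-Stage i x with toℕ x <? toℕ i
... | yes x<i = step-Stage-below x x<i
... | no  x≮i = step-Stage-above x (≮⇒≥ x≮i)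

◇-Stage : ∀ {d} (i : Fin (suc (suc d))) → ◇ ⟨ Γface i ⟩ ≅ Stage i (suc d)
◇-Stage i = ◇-≅ (Stage i) (step-Stage i) Γface≅Stage₀
  where
    Γface≅Stage₀ : ⟨ Γface i ⟩ ≅ Stage i 0
    Γface≅Stage₀ G = to , from
      where
        to : ⟨ Γface i ⟩ G → Stage i 0 G
        to G⊆Γ .omits-i g = not-true⇒¬true (G⊆Γ (old i) g) (≡⇒≡ᵇ-true {toℕ i} refl)
        to G⊆Γ .new-range j g = contradiction (G⊆Γ (new j) g) λ ()
        to G⊆Γ .no-antipodal j ()
        to G⊆Γ .misses-tail = omits⇒misses-tail {G = G} z≤n (to G⊆Γ .omits-i)

        from : Stage i 0 G → ⟨ Γface i ⟩ G
        from s (old j) g = ¬true⇒not-true λ i≡j →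
          s .omits-i (subst (λ z → G ∋ old z) (toℕ-injective (sym (≡ᵇ-true⇒≡ i≡j))) g)
        from s (new j) g with s .new-range j g
        ... | _ , ()

Stage≅allButLast : ∀ {d} → Stage (fromℕ (suc d)) (suc d) ≅ ⟨ allButLast {d} ⟩
Stage≅allButLast {d} G = to , from
  where
    top : Fin (suc (suc d))
    top = fromℕ (suc d)

    to : Stage top (suc d) G → ⟨ allButLast ⟩ G
    to s (old j) g = ≤⇒≤ᵇ-true (s≤s⁻¹ (≤∧≢⇒< (s≤s⁻¹ (toℕ<n j)) j≢top))
      where
        j≢top : toℕ j ≢ suc d
        j≢top j≡top = s .omits-i (subst (λ z → G ∋ old z) (toℕ-injective (trans j≡top (sym (toℕ-fromℕ (suc d))))) g)
    to s (new j) g = contradiction (subst (_≤ toℕ j) (toℕ-fromℕ (suc d)) (proj₁ (s .new-range j g))) (<⇒≱ (toℕ<n j))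

    from : ⟨ allButLast ⟩ G → Stage top (suc d) G
    from G⊆ .omits-i g = 1+n≰n (subst (_≤ d) (toℕ-fromℕ (suc d)) (≤ᵇ-true⇒≤ (G⊆ (old top) g)))
    from G⊆ .new-range j g = contradiction (G⊆ (new j) g) λ ()
    from G⊆ .no-antipodal j _ _ w = contradiction (G⊆ (new j) w) λ ()
    from G⊆ .misses-tail = omits⇒misses-tail {G = G} (≤-reflexive (sym (toℕ-fromℕ (suc d)))) (from G⊆ .omits-i)

record CrossFace {d} (i : Fin (suc d)) (G : Face d) : Set where
  field
    cross-old       : ∀ j → G ∋ old j → toℕ i < toℕ j × toℕ j ≤ d
    cross-new       : ∀ j → G ∋ new j → toℕ i < toℕ j
    cross-antipodal : ∀ j → G ∋ old (inject₁ j) → ¬ G ∋ new j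

open CrossFace

module _ {d : ℕ} (i : Fin (suc d)) where

  cross-downClosed : DownClosed (cross i)
  cross-downClosed G⊆H (K , K-facet , H⊆K) = K , K-facet , λ y → H⊆K y ∘ G⊆H y

  cross≅CrossFace : cross i ≅ CrossFace i
  cross≅CrossFace G = to , from
    where
      to : cross i G → CrossFace i G
      to (H , (H-old , H-new , H-xor) , G⊆H) .cross-old j g =
        let i<j∧j≤d = H-old j (G⊆H _ g) in
        <ᵇ-true⇒< (∧-conicalˡ _ _ i<j∧j≤d) , ≤ᵇ-true⇒≤ (∧-conicalʳ _ _ i<j∧j≤d)
      to (H , (H-old , H-new , H-xor) , G⊆H) .cross-new j g = <ᵇ-true⇒< (H-new j (G⊆H _ g))
      to (H , (H-old , H-new , H-xor) , G⊆H) .cross-antipodal j o w =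
        contradiction (trans (sym (cong₂ _xor_ (G⊆H _ o) (G⊆H _ w))) (H-xor j (H-new j (G⊆H _ w)))) λ ()

      from : CrossFace i G → cross i G
      from c = H , (H-old , H-new , H-xor) , G⊆H
        where
          H : Face d
          H (old j) = G (old j)
          H (new j) = (toℕ i <ᵇ toℕ j) ∧ not (G (old (inject₁ j)))

          H-old : ∀ j → H ∋ old j → (toℕ i <ᵇ toℕ j) ∧ (toℕ j ≤ᵇ d) ≡ true
          H-old j h = cong₂ _∧_ (<⇒<ᵇ-true (proj₁ (c .cross-old j h))) (≤⇒≤ᵇ-true (proj₂ (c .cross-old j h)))

          H-new : ∀ j → H ∋ new j → (toℕ i <ᵇ toℕ j) ≡ true
          H-new j = ∧-conicalˡ _ _

          H-xor : ∀ j → (toℕ i <ᵇ toℕ j) ≡ true → (H (old (inject₁ j)) xor H (new j)) ≡ true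
          H-xor j i<j rewrite i<j = xor-inverseʳ (G (old (inject₁ j)))

          G⊆H : G ⊆ H
          G⊆H (old j) g = g
          G⊆H (new j) g = cong₂ _∧_ (<⇒<ᵇ-true (c .cross-new j g)) (¬true⇒not-true λ o → c .cross-antipodal j o g)

  headFace-✶-cross : (⟨ headFace i ⟩ ✶ cross i) ≅ (λ G → CrossFace i (G ─ headFace i))
  headFace-✶-cross = ≅-trans (simplex-✶ (headFace i) cross-downClosed) λ G → cross≅CrossFace (G ─ headFace i)

  Stage≅CrossFace-off-head : Stage (inject₁ i) (suc d) ≅ (λ G → CrossFace i (G ─ headFace i))
  Stage≅CrossFace-off-head G = to , from
    where
      G─h : Face d
      G─h = G ─ headFace i

      top : Fin (suc (suc d))
      top = fromℕ (suc d)

      to : Stage (inject₁ i) (suc d) G → CrossFace i G─h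
      to s .cross-old j g─h with ─-∋⁻ G (headFace i) g─h
      ... | g , j≮i = ≤∧≢⇒< (≮⇒≥ (j≮i ∘ <⇒<ᵇ-true)) i≢j , s≤s⁻¹ (≤∧≢⇒< (s≤s⁻¹ (toℕ<n j)) j≢top)
        where
          i≢j : toℕ i ≢ toℕ j
          i≢j i≡j = s .omits-i (subst (λ z → G ∋ old z) (toℕ-injective (trans (sym i≡j) (sym (toℕ-inject₁ i)))) g)
          j≢top : toℕ j ≢ suc d
          j≢top j≡top = s .misses-tail λ j' d<j' →
            subst (λ z → G ∋ old z) (toℕ-injective (trans j≡top (≤-antisym d<j' (s≤s⁻¹ (toℕ<n j'))))) g
      to s .cross-new j g─h with ─-∋⁻ G (headFace i) g─h
      ... | g , j≢i = ≤∧≢⇒< (subst (_≤ toℕ j) (toℕ-inject₁ i) (proj₁ (s .new-range j g)))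
                            (λ i≡j → j≢i (≡⇒≡ᵇ-true (sym i≡j)))
      to s .cross-antipodal j o w =
        s .no-antipodal j (toℕ<n j) (proj₁ (─-∋⁻ G (headFace i) o)) (proj₁ (─-∋⁻ G (headFace i) w))

      from : CrossFace i G─h → Stage (inject₁ i) (suc d) G
      from c .omits-i g =
        [ <-irrefl (toℕ-inject₁ i) ∘ <ᵇ-true⇒<
        , <-irrefl (sym (toℕ-inject₁ i)) ∘ proj₁ ∘ c .cross-old (inject₁ i) ]′
        (─-split G (headFace i) g)
      from c .new-range j g =
        subst (_≤ toℕ j) (sym (toℕ-inject₁ i))
          ([ ≤-reflexive ∘ sym ∘ ≡ᵇ-true⇒≡ , <⇒≤ ∘ c .cross-new j ]′ (─-split G (headFace i) g))
        , toℕ<n j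
      from c .no-antipodal j _ o w with ─-split G (headFace i) o | ─-split G (headFace i) w
      ... | inj₁ j<i | inj₁ j≡i = <-irrefl (trans (toℕ-inject₁ j) (≡ᵇ-true⇒≡ j≡i)) (<ᵇ-true⇒< j<i)
      ... | inj₂ o⁻  | inj₁ j≡i =
        <-irrefl (sym (trans (toℕ-inject₁ j) (≡ᵇ-true⇒≡ j≡i))) (proj₁ (c .cross-old (inject₁ j) o⁻))
      ... | inj₁ j<i | inj₂ w⁻  = <-asym (c .cross-new j w⁻) (subst (_< toℕ i) (toℕ-inject₁ j) (<ᵇ-true⇒< j<i))
      ... | inj₂ o⁻  | inj₂ w⁻  = c .cross-antipodal j o⁻ w⁻
      from c .misses-tail tail =
        [ (λ top<i → <⇒≱ (toℕ<n i) (<⇒≤ (subst (_< toℕ i) (toℕ-fromℕ (suc d)) (<ᵇ-true⇒< top<i))))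
        , (λ g─h → 1+n≰n (subst (_≤ d) (toℕ-fromℕ (suc d)) (proj₂ (c .cross-old top g─h)))) ]′
        (─-split G (headFace i) (tail top (≤-reflexive (sym (toℕ-fromℕ (suc d))))))

lemma3p17 : (d : ℕ) →
    ((i : Fin (suc d)) → ◇ ⟨ Γface (inject₁ i) ⟩ ≅ (⟨ headFace i ⟩ ✶ cross i))
    × (◇ ⟨ Γface {d} (fromℕ (suc d)) ⟩ ≅ ⟨ allButLast ⟩)
lemma3p17 d =
  (λ i → ≅-trans (◇-Stage (inject₁ i)) (≅-trans (Stage≅CrossFace-off-head i) (≅-sym (headFace-✶-cross i))))
  , ≅-trans (◇-Stage (fromℕ (suc d))) Stage≅allButLast
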